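{- Let $G$ and $H$ be cographs. Assume $H$ is disconnected, with components $H_1,\dots,H_t$, and assume that $H$ is a retract of $G$. Then there is an ordering $G_1,\dots,G_s$ of the components of $G$ such that (a) $s\ge t$; (b) $G_i$ retracts to $H_i$ for every $i\in\{1,\dots,t\}$; and (c) for every $j\in\{t+1,\dots,s\}$ there is a homomorphism $G_j\to H$.
   Context: All graphs are finite and simple; components are regarded as induced subgraphs. A cograph is a graph with no induced subgraph isomorphic to $P_4$, the path on four vertices. A homomorphism $\phi: G\to H$ is a map $V(G)\to V(H)$ such that $\{x,y\}\in E(G)$ implies $\{\phi(x),\phi(y)\}\in E(H)$. The graph $H$ is a retract of $G$ (equivalently, $G$ retracts to $H$) if there exist homomorphisms $\rho: G\to H$ and $\gamma: H\to G$ with $\rho\circ\gamma=\mathrm{id}_{V(H)}$. -}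

module Defs where

open import Data.Nat using (ℕ)
open import Data.Fin using (Fin)
open import Data.Bool using (Bool; true; false)
open import Data.Product using (Σ; ∃; _×_; _,_; proj₁)
open import Relation.Binary.PropositionalEquality using (_≡_)
open import Relation.Nullary using (¬_)
open import Function.Bundles using (_⇔_)

record FinGraph : Set where
  field
    n      : ℕ
    adj    : Fin n → Fin n → Bool
    sym    : ∀ x y → adj x y ≡ adj y x
    irrefl : ∀ x → adj x x ≡ false

open FinGraph public

Edge : (G : FinGraph) → Fin (n G) → Fin (n G) → Set
Edge G x y = adj G x y ≡ true

record Graph : Set₁ where
  field
    V : Set
    E : V → V → Set

open Graph public

⟦_⟧ : FinGraph → Graph
⟦ G ⟧ = record { V = Fin (n G) ; E = Edge G }

Induced : (G : FinGraph) → (Fin (n G) → Set) → Graph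
Induced G P = record { V = Σ (Fin (n G)) P ; E = λ x y → Edge G (proj₁ x) (proj₁ y) }

Hom : Graph → Graph → Set
Hom G H = Σ (V G → V H) λ f → ∀ {x y} → E G x y → E H (f x) (f y)

Retract : Graph → Graph → Set
Retract G H = Σ (Hom G H) λ ρ → Σ (Hom H G) λ γ → ∀ y → proj₁ ρ (proj₁ γ y) ≡ y

data Reachable (G : FinGraph) : Fin (n G) → Fin (n G) → Set where
  here : ∀ {x} → Reachable G x x
  step : ∀ {x y z} → Edge G x y → Reachable G y z → Reachable G x z

Disconnected : FinGraph → Set
Disconnected G = ∃ λ x → ∃ λ y → ¬ Reachable G x y

-- An ordering of the components of G as G_1,…,G_s: a surjective labelling
-- c : V(G) → Fin s whose fibres are exactly the connected components.
ComponentOrdering : (G : FinGraph) (s : ℕ) → (Fin (n G) → Fin s) → Set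
ComponentOrdering G s c =
  (∀ x y → (c x ≡ c y) ⇔ Reachable G x y) × (∀ i → ∃ λ x → c x ≡ i)

Component : (G : FinGraph) {s : ℕ} → (Fin (n G) → Fin s) → Fin s → Graph
Component G c i = Induced G (λ x → c x ≡ i)

-- Cograph: no induced P4 (a-b-c-d path with ac, ad, bd non-edges;
-- these conditions force a,b,c,d to be distinct).
Cograph : FinGraph → Set
Cograph G = ¬ (∃ λ a → ∃ λ b → ∃ λ c → ∃ λ d →
  adj G a b ≡ true × adj G b c ≡ true × adj G c d ≡ true ×
  adj G a c ≡ false × adj G a d ≡ false × adj G b d ≡ false)

-- Let ρ : G → H, γ : H → G be homomorphisms with ρ ∘ γ = id.  Since
-- homomorphisms preserve reachability, ρ maps the component of G
-- containing γ(y) into the component of H containing y and γ maps it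
-- back, so the former component retracts to the latter.  Also γ(y), γ(y′)
-- share a component only if y, y′ do; so choosing hᵢ ∈ Hᵢ yields t
-- pairwise inequivalent vertices γ(hᵢ) of G.  Such a partial transversal
-- of a decidable equivalence on Fin N extends to a labelling of all
-- classes by Fin (t + m) giving the class of γ(hᵢ) the label i.
module Submission where

open import Defs
open import Data.Nat using (ℕ; _≤_; _+_)
open import Data.Nat.Properties using (m≤m+n)
open import Data.Fin using (Fin; zero; suc; toℕ; _<_; _↑ˡ_; splitAt; join)
open import Data.Fin.Properties using (_≟_; any?; _<?_; <-cmp; splitAt-↑ˡ; splitAt-join; join-splitAt; toℕ-↑ˡ; toℕ-injective)
open import Data.Fin.Induction using (<-wellFounded)
open import Data.Fin.Subset using (Subset; _∈_; _∪_; ⁅_⁆; _⊂_; _⊃_)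
open import Data.Fin.Subset.Properties using (_∈?_; x∈⁅x⁆; x∈⁅y⁆⇒x≡y; p⊆p∪q; x∈p∪q⁻; x∈p∪q⁺)
open import Data.Fin.Subset.Induction using (⊃-wellFounded)
open import Induction.WellFounded using (Acc; acc)
open import Data.Bool using (true)
open import Data.Bool.Properties using () renaming (_≟_ to _≟ᵇ_)
open import Data.Product using (Σ; ∃; _×_; _,_; proj₁; proj₂)
open import Data.Sum using (_⊎_; inj₁; inj₂; [_,_]′)
open import Data.Empty using (⊥-elim)
open import Relation.Nullary using (¬_; Dec; yes; no)
open import Relation.Nullary.Decidable using (_×-dec_; ¬?)
open import Relation.Binary using (IsDecEquivalence; tri<; tri≈; tri>)
open import Relation.Binary.PropositionalEquality using (_≡_; refl; cong; subst; trans) renaming (sym to ≡-sym)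
open import Function.Bundles using (_⇔_; mk⇔; Equivalence)
open import Data.List using (List; _∷_; filter; allFin; length; lookup)
open import Data.List.Membership.Propositional using () renaming (_∈_ to _∈ₗ_)
open import Data.List.Membership.Propositional.Properties using (∈-filter⁺; ∈-filter⁻; ∈-allFin; ∈-lookup)
open import Data.List.Relation.Unary.Any using (index)
open import Data.List.Relation.Unary.Any.Properties using (lookup-index)
open import Data.List.Relation.Unary.All as All using ()
open import Data.List.Relation.Unary.Unique.Propositional using (Unique)
import Data.List.Relation.Unary.Unique.Propositional.Properties as Unique
open import Data.List.Relation.Unary.AllPairs using (_∷_)
open import Axiom.UniquenessOfIdentityProofs using (module Decidable⇒UIP)

module _ (G : FinGraph) where

  edge-sym : ∀ {x y} → Edge G x y → Edge G y x
  edge-sym {x} {y} e = trans (sym G y x) e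

  reach-trans : ∀ {x y z} → Reachable G x y → Reachable G y z → Reachable G x z
  reach-trans here       q = q
  reach-trans (step e p) q = step e (reach-trans p q)

  reach-sym : ∀ {x y} → Reachable G x y → Reachable G y x
  reach-sym here       = here
  reach-sym (step e p) = reach-trans (reach-sym p) (step (edge-sym e) here)

  edge? : ∀ x y → Dec (Edge G x y)
  edge? x y = adj G x y ≟ᵇ true

  -- Reachability from x is decided by computing the set of vertices
  -- reachable from x: a set containing x, reachable from x, and closed
  -- under edges.  It is found by repeatedly adding a missing neighbour,
  -- which terminates because subsets of Fin n cannot grow forever.
  module ReachableSet (x : Fin (n G)) where

    Sound : Subset (n G) → Set
    Sound S = x ∈ S × (∀ {y} → y ∈ S → Reachable G x y)

    Closed : Subset (n G) → Set
    Closed S = ∀ {y z} → y ∈ S → Edge G y z → z ∈ S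

    leaving-edge? : (S : Subset (n G)) → Closed S ⊎ ∃ λ y → ∃ λ z → y ∈ S × ¬ z ∈ S × Edge G y z
    leaving-edge? S with any? (λ y → any? (λ z → (y ∈? S) ×-dec (¬? (z ∈? S) ×-dec edge? y z)))
    ... | yes (y , z , leaving) = inj₂ (y , z , leaving)
    ... | no ¬leaving = inj₁ closed
      where
      closed : Closed S
      closed {y} {z} y∈S e with z ∈? S
      ... | yes z∈S = z∈S
      ... | no  z∉S = ⊥-elim (¬leaving (y , z , y∈S , z∉S , e))

    grow : (S : Subset (n G)) → Acc _⊃_ S → Sound S → Σ (Subset (n G)) λ C → Sound C × Closed C
    grow S (acc smaller) (x∈S , reach) with leaving-edge? S
    ... | inj₁ closed = S , (x∈S , reach) , closed
    ... | inj₂ (y , z , y∈S , z∉S , e) =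
      grow S′ (smaller S⊂S′) (x∈p∪q⁺ (inj₁ x∈S) , reach′)
      where
      S′ : Subset (n G)
      S′ = S ∪ ⁅ z ⁆
      S⊂S′ : S ⊂ S′
      S⊂S′ = p⊆p∪q ⁅ z ⁆ , z , x∈p∪q⁺ (inj₂ (x∈⁅x⁆ z)) , z∉S
      reach′ : ∀ {w} → w ∈ S′ → Reachable G x w
      reach′ w∈S′ with x∈p∪q⁻ S ⁅ z ⁆ w∈S′
      ... | inj₁ w∈S = reach w∈S
      ... | inj₂ w∈⁅z⁆ with x∈⁅y⁆⇒x≡y z w∈⁅z⁆
      ... | refl = reach-trans (reach y∈S) (step e here)

    reachableSet : Σ (Subset (n G)) λ C → Sound C × Closed C
    reachableSet = grow ⁅ x ⁆ (⊃-wellFounded _) (x∈⁅x⁆ x , λ w∈⁅x⁆ → subst (Reachable G x) (≡-sym (x∈⁅y⁆⇒x≡y x w∈⁅x⁆)) here)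

    closed-complete : ∀ {C u y} → Closed C → u ∈ C → Reachable G u y → y ∈ C
    closed-complete closed u∈C here       = u∈C
    closed-complete closed u∈C (step e p) = closed-complete closed (closed u∈C e) p

  reach? : ∀ x y → Dec (Reachable G x y)
  reach? x y = decide reachableSet
    where
    open ReachableSet x
    decide : (Σ (Subset (n G)) λ C → Sound C × Closed C) → Dec (Reachable G x y)
    decide (C , (x∈C , sound) , closed) with y ∈? C
    ... | yes y∈C = yes (sound y∈C)
    ... | no  y∉C = no λ r → y∉C (closed-complete closed x∈C r)

  reachable-isDecEquivalence : IsDecEquivalence (Reachable G)
  reachable-isDecEquivalence = record
    { isEquivalence = record { refl = here ; sym = reach-sym ; trans = reach-trans }
    ; _≟_           = reach?
    }

module ClassLabelling {N : ℕ} {_~_ : Fin N → Fin N → Set} (isDecEq : IsDecEquivalence _~_) where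

  open IsDecEquivalence isDecEq renaming (refl to ~-refl; sym to ~-sym; trans to ~-trans; _≟_ to _~?_)

  Labels : {s : ℕ} → (Fin N → Fin s) → Set
  Labels c = (∀ x y → (c x ≡ c y) ⇔ (x ~ y)) × (∀ j → ∃ λ x → c x ≡ j)

  record Transversal (s : ℕ) : Set where
    field
      rep      : Fin s → Fin N
      distinct : ∀ j k → rep j ~ rep k → j ≡ k
      covers   : ∀ x → ∃ λ j → x ~ rep j

  transversal⇒labels : ∀ {s} (T : Transversal s) → let open Transversal T in
    Σ (Fin N → Fin s) λ c → Labels c × (∀ j → c (rep j) ≡ j)
  transversal⇒labels {s} T = c , (classes , λ j → rep j , label-rep ~-refl) , λ j → label-rep ~-refl
    where
    open Transversal T
    c : Fin N → Fin s
    c x = proj₁ (covers x)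
    label-rep : ∀ {x j} → x ~ rep j → c x ≡ j
    label-rep {x} x~rep = distinct _ _ (~-trans (~-sym (proj₂ (covers x))) x~rep)
    classes : ∀ x y → (c x ≡ c y) ⇔ (x ~ y)
    classes x y = mk⇔ same-label⇒~ (λ x~y → label-rep (~-trans x~y (proj₂ (covers y))))
      where
      same-label⇒~ : c x ≡ c y → x ~ y
      same-label⇒~ eq = ~-trans (proj₂ (covers x)) (subst (λ j → rep j ~ y) (≡-sym eq) (~-sym (proj₂ (covers y))))

  Least : Fin N → Set
  Least z = ¬ (∃ λ w → w < z × z ~ w)

  least? : ∀ z → Dec (Least z)
  least? z = ¬? (any? (λ w → (w <? z) ×-dec (z ~? w)))

  least-unique : ∀ {y z} → Least y → Least z → y ~ z → y ≡ z
  least-unique {y} {z} least-y least-z y~z with <-cmp y z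
  ... | tri< y<z _ _ = ⊥-elim (least-z (y , y<z , ~-sym y~z))
  ... | tri≈ _ y≡z _ = y≡z
  ... | tri> _ _ z<y = ⊥-elim (least-y (z , z<y , y~z))

  least-in-class : ∀ y → ∃ λ z → y ~ z × Least z
  least-in-class y = search y (<-wellFounded y)
    where
    search : ∀ y → Acc _<_ y → ∃ λ z → y ~ z × Least z
    search y (acc smaller) with any? (λ w → (w <? y) ×-dec (y ~? w))
    ... | no least = y , ~-refl , least
    ... | yes (w , w<y , y~w) with search w (smaller w<y)
    ... | z , w~z , least = z , ~-trans y~w w~z , least

  lookup-injective : ∀ {A : Set} (xs : List A) → Unique xs → ∀ i j → lookup xs i ≡ lookup xs j → i ≡ j
  lookup-injective (x ∷ xs) u           zero    zero    eq = refl
  lookup-injective (x ∷ xs) (x∉xs ∷ u)  zero    (suc j) eq = ⊥-elim (All.lookup x∉xs (∈-lookup j) eq)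
  lookup-injective (x ∷ xs) (x∉xs ∷ u)  (suc i) zero    eq = ⊥-elim (All.lookup x∉xs (∈-lookup i) (≡-sym eq))
  lookup-injective (x ∷ xs) (x∉xs ∷ u)  (suc i) (suc j) eq = cong suc (lookup-injective xs u i j eq)

  -- The new representatives are the least elements of the classes
  -- containing no root.
  extend-transversal : ∀ {t} (root : Fin t → Fin N) → (∀ i k → root i ~ root k → i ≡ k) →
    Σ ℕ λ m → Σ (Transversal (t + m)) λ T → ∀ i → Transversal.rep T (i ↑ˡ m) ≡ root i
  extend-transversal {t} root root-distinct = m , T , λ i → cong rep′ (splitAt-↑ˡ t i m)
    where
    Unrooted : Fin N → Set
    Unrooted z = ¬ (∃ λ i → root i ~ z)

    New : Fin N → Set
    New z = Least z × Unrooted z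

    new? : ∀ z → Dec (New z)
    new? z = least? z ×-dec ¬? (any? (λ i → root i ~? z))

    news : List (Fin N)
    news = filter new? (allFin N)

    m : ℕ
    m = length news

    new : ∀ k → New (lookup news k)
    new k = proj₂ (∈-filter⁻ new? {xs = allFin N} (∈-lookup {xs = news} k))

    rep′ : Fin t ⊎ Fin m → Fin N
    rep′ = [ root , lookup news ]′

    distinct′ : ∀ a b → rep′ a ~ rep′ b → a ≡ b
    distinct′ (inj₁ i) (inj₁ k) r = cong inj₁ (root-distinct i k r)
    distinct′ (inj₁ i) (inj₂ k) r = ⊥-elim (proj₂ (new k) (i , r))
    distinct′ (inj₂ k) (inj₁ i) r = ⊥-elim (proj₂ (new k) (i , ~-sym r))
    distinct′ (inj₂ k) (inj₂ l) r = cong inj₂ (lookup-injective news (Unique.filter⁺ new? (Unique.allFin⁺ N)) k l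
                                      (least-unique (proj₁ (new k)) (proj₁ (new l)) r))

    covers′ : ∀ x → ∃ λ a → x ~ rep′ a
    covers′ x with any? (λ i → root i ~? x)
    ... | yes (i , root~x) = inj₁ i , ~-sym root~x
    ... | no unrooted with least-in-class x
    ... | z , x~z , least = inj₂ (index z∈news) , subst (x ~_) (lookup-index z∈news) x~z
      where
      z∈news : z ∈ₗ news
      z∈news = ∈-filter⁺ new? {xs = allFin N} (∈-allFin z) (least , λ (i , root~z) → unrooted (i , ~-trans root~z (~-sym x~z)))

    T : Transversal (t + m)
    T = record
      { rep      = λ j → rep′ (splitAt t j)
      ; distinct = λ j k r → splitAt-injective (distinct′ (splitAt t j) (splitAt t k) r)
      ; covers   = λ x → covers-join x (covers′ x)
      }
      where
      splitAt-injective : ∀ {j k} → splitAt t j ≡ splitAt t k → j ≡ k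
      splitAt-injective {j} {k} eq = trans (≡-sym (join-splitAt t m j)) (trans (cong (join t m) eq) (join-splitAt t m k))
      covers-join : ∀ x → (∃ λ a → x ~ rep′ a) → ∃ λ j → x ~ rep′ (splitAt t j)
      covers-join x (a , x~a) = join t m a , subst (λ b → x ~ rep′ b) (≡-sym (splitAt-join t m a)) x~a

  labels-extending : ∀ {t} (root : Fin t → Fin N) → (∀ i k → root i ~ root k → i ≡ k) →
    Σ ℕ λ m → Σ (Fin N → Fin (t + m)) λ c → Labels c × (∀ i → c (root i) ≡ i ↑ˡ m)
  labels-extending root root-distinct with extend-transversal root root-distinct
  ... | m , T , rep≡root with transversal⇒labels T
  ... | c , c-labels , c-rep = m , c , c-labels , λ i → subst (λ x → c x ≡ i ↑ˡ m) (rep≡root i) (c-rep (i ↑ˡ m))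

hom-reach : (G H : FinGraph) (φ : Hom ⟦ G ⟧ ⟦ H ⟧) → ∀ {x y} → Reachable G x y → Reachable H (proj₁ φ x) (proj₁ φ y)
hom-reach G H φ here       = here
hom-reach G H φ (step e p) = step (proj₂ φ e) (hom-reach G H φ p)

restrict-hom : (G : FinGraph) (P : Fin (n G) → Set) {K : Graph} → Hom ⟦ G ⟧ K → Hom (Induced G P) K
restrict-hom G P (φ , φ-edge) = (λ v → φ (proj₁ v)) , φ-edge

component-≡ : ∀ {m k} {d : Fin m → Fin k} {i : Fin k} {a a′ : Fin m} → a ≡ a′ → (p : d a ≡ i) (q : d a′ ≡ i) →
  _≡_ {A = Σ (Fin m) λ y → d y ≡ i} (a , p) (a′ , q)
component-≡ refl p q = cong (_ ,_) (Decidable⇒UIP.≡-irrelevant _≟_ p q)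

module _ (G H : FinGraph) (ρ : Hom ⟦ G ⟧ ⟦ H ⟧) (γ : Hom ⟦ H ⟧ ⟦ G ⟧) (ργ : ∀ y → proj₁ ρ (proj₁ γ y) ≡ y) where

  retraction-reach : ∀ {x y} → Reachable G x (proj₁ γ y) → Reachable H (proj₁ ρ x) y
  retraction-reach {y = y} r = subst (Reachable H _) (ργ y) (hom-reach G H ρ r)

  retraction-reflects : ∀ {y y′} → Reachable G (proj₁ γ y) (proj₁ γ y′) → Reachable H y y′
  retraction-reflects {y} r = subst (λ a → Reachable H a _) (ργ y) (retraction-reach r)

  component-retract : ∀ {s t} (c : Fin (n G) → Fin s) (d : Fin (n H) → Fin t) →
    (∀ x y → (c x ≡ c y) ⇔ Reachable G x y) → (∀ x y → (d x ≡ d y) ⇔ Reachable H x y) →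
    ∀ y {i j} → d y ≡ i → c (proj₁ γ y) ≡ j → Retract (Component G c j) (Component H d i)
  component-retract c d c-classes d-classes y {i} {j} dy≡i cγy≡j = (ρ′ , proj₂ ρ) , (γ′ , proj₂ γ) , ρ′γ′
    where
    ρ′ : Σ (Fin (n G)) (λ x → c x ≡ j) → Σ (Fin (n H)) (λ z → d z ≡ i)
    ρ′ (x , cx≡j) = proj₁ ρ x , trans (Equivalence.from (d-classes _ y) (retraction-reach x~γy)) dy≡i
      where
      x~γy : Reachable G x (proj₁ γ y)
      x~γy = Equivalence.to (c-classes x (proj₁ γ y)) (trans cx≡j (≡-sym cγy≡j))
    γ′ : Σ (Fin (n H)) (λ z → d z ≡ i) → Σ (Fin (n G)) (λ x → c x ≡ j)
    γ′ (z , dz≡i) = proj₁ γ z , trans (Equivalence.from (c-classes _ _) (hom-reach H G γ z~y)) cγy≡j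
      where
      z~y : Reachable H z y
      z~y = Equivalence.to (d-classes z y) (trans dz≡i (≡-sym dy≡i))
    ρ′γ′ : ∀ v → ρ′ (γ′ v) ≡ v
    ρ′γ′ (z , dz≡i) = component-≡ (ργ z) _ dz≡i

mainTheorem7 : (G H : FinGraph) → Cograph G → Cograph H → Disconnected H →
    (t : ℕ) (d : Fin (n H) → Fin t) → ComponentOrdering H t d →
    Retract ⟦ G ⟧ ⟦ H ⟧ →
    Σ ℕ λ s → Σ (Fin (n G) → Fin s) λ c → ComponentOrdering G s c ×
    (t ≤ s) ×
    (∀ (i : Fin t) (j : Fin s) → toℕ j ≡ toℕ i → Retract (Component G c j) (Component H d i)) ×
    (∀ (j : Fin s) → t ≤ toℕ j → Hom (Component G c j) ⟦ H ⟧)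
mainTheorem7 G H _ _ _ t d (d-classes , d-onto) (ρ , γ , ργ) =
  t + m , c , c-labels , m≤m+n t m , retracts , λ j _ → restrict-hom G _ {⟦ H ⟧} ρ
  where
  open ClassLabelling (reachable-isDecEquivalence G)
  h : Fin t → Fin (n H)
  h i = proj₁ (d-onto i)
  root : Fin t → Fin (n G)
  root i = proj₁ γ (h i)
  roots-distinct : ∀ i k → Reachable G (root i) (root k) → i ≡ k
  roots-distinct i k r = trans (≡-sym (proj₂ (d-onto i)))
    (trans (Equivalence.from (d-classes _ _) (retraction-reflects G H ρ γ ργ r)) (proj₂ (d-onto k)))
  labelling : Σ ℕ λ m → Σ (Fin (n G) → Fin (t + m)) λ c → Labels c × (∀ i → c (root i) ≡ i ↑ˡ m)
  labelling = labels-extending root roots-distinct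
  m : ℕ
  m = proj₁ labelling
  c : Fin (n G) → Fin (t + m)
  c = proj₁ (proj₂ labelling)
  c-labels : Labels c
  c-labels = proj₁ (proj₂ (proj₂ labelling))
  -- The component labelled i ∈ Fin t is the one containing γ(hᵢ).
  retracts : ∀ (i : Fin t) (j : Fin (t + m)) → toℕ j ≡ toℕ i → Retract (Component G c j) (Component H d i)
  retracts i j j≡i = component-retract G H ρ γ ργ c d (proj₁ c-labels) d-classes (h i) (proj₂ (d-onto i)) c-root≡j
    where
    c-root≡j : c (root i) ≡ j
    c-root≡j = trans (proj₂ (proj₂ (proj₂ labelling)) i) (toℕ-injective (trans (toℕ-↑ˡ i m) (≡-sym j≡i)))
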